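{- Let $\Gamma$ be a connected weighted graph with weighted Laplacian $L$, and let $\sigma: V(\Gamma)\to\mathbb{Z}$ be a firing script with $L\sigma = \mathbf{0}$. Then $\sigma(u)w(u) = \sigma(v)w(v)$ for all $u,v \in V(\Gamma)$.
   Context: A weighted graph $\Gamma$ is a finite connected multigraph without loops, with vertex set $V(\Gamma)$, edge set $E(\Gamma)$, and weights $w: V(\Gamma)\cup E(\Gamma)\to\mathbb{Z}_{>0}$ such that the weight of each edge divides the weights of both of its endpoints. $E(v)$ denotes the set of edges incident to $v$ and $E(u,v)$ the set of edges joining $u$ and $v$. The weighted valency is $\mathrm{val}(v)=\sum_{e\in E(v)} w(v)/w(e)$. A firing script is a function $\sigma: V(\Gamma)\to\mathbb{Z}$ ($\sigma(v)$ is the net number of lending moves at $v$). With vertices $v_1,\dots,v_n$, the weighted Laplacian is the $n\times n$ integer matrix $L$ with $L_{ii}=\mathrm{val}(v_i)$ and $L_{ij} = -\sum_{e\in E(v_i,v_j)} w(v_j)/w(e)$ for $i\neq j$; applying the script $\sigma$ to a divisor $D: V(\Gamma)\to\mathbb{Z}$ yields $D - L\sigma$. -}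

module Defs where

open import Data.Nat as ℕ using (ℕ; zero; suc; NonZero)
open import Data.Nat.Divisibility using (_∣_)
open import Data.Nat.DivMod using (_/_)
open import Data.Integer as ℤ using (ℤ; +_; -_)
open import Data.Fin using (Fin; zero; suc; _≟_)
open import Data.Product using (∃; _×_)
open import Data.Sum using (_⊎_)
open import Relation.Nullary using (¬_; yes; no)
open import Relation.Nullary.Decidable using (⌊_⌋)
open import Relation.Binary.PropositionalEquality using (_≡_)
open import Relation.Binary.Construct.Closure.ReflexiveTransitive using (Star)
open import Data.Bool using (Bool; true; false; if_then_else_; _∧_; _∨_)

∑ : (n : ℕ) → (Fin n → ℤ) → ℤ
∑ zero    f = + 0
∑ (suc n) f = f zero ℤ.+ ∑ n (λ i → f (suc i))

-- A weighted multigraph without loops, with vertices Fin n and edges Fin m.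
-- Edge e joins src e and tgt e (orientation irrelevant).
record WeightedGraph (n m : ℕ) : Set where
  field
    src tgt : Fin m → Fin n
    noLoop  : ∀ e → ¬ (src e ≡ tgt e)
    wV      : Fin n → ℕ
    wE      : Fin m → ℕ
    wV-pos  : ∀ v → NonZero (wV v)
    wE-pos  : ∀ e → NonZero (wE e)
    wE∣src  : ∀ e → wE e ∣ wV (src e)
    wE∣tgt  : ∀ e → wE e ∣ wV (tgt e)

module _ {n m : ℕ} (G : WeightedGraph n m) where
  open WeightedGraph G

  Adjacent : Fin n → Fin n → Set
  Adjacent u v = ∃ λ e → (src e ≡ u × tgt e ≡ v) ⊎ (src e ≡ v × tgt e ≡ u)

  Connected : Set
  Connected = ∀ u v → Star Adjacent u v

  ratio : Fin n → Fin m → ℤ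
  ratio x e = + (_/_ (wV x) (wE e) {{wE-pos e}})

  incident : Fin n → Fin m → Bool
  incident v e = ⌊ src e ≟ v ⌋ ∨ ⌊ tgt e ≟ v ⌋

  joins : Fin n → Fin n → Fin m → Bool
  joins u v e = (⌊ src e ≟ u ⌋ ∧ ⌊ tgt e ≟ v ⌋) ∨ (⌊ src e ≟ v ⌋ ∧ ⌊ tgt e ≟ u ⌋)

  val : Fin n → ℤ
  val v = ∑ m (λ e → if incident v e then ratio v e else + 0)

  Laplacian : Fin n → Fin n → ℤ
  Laplacian i j with i ≟ j
  ... | yes _ = val i
  ... | no  _ = - ∑ m (λ e → if joins i j e then ratio j e else + 0)

  applyL : (Fin n → ℤ) → Fin n → ℤ
  applyL σ i = ∑ n (λ j → Laplacian i j ℤ.* σ j)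

{-# OPTIONS --safe #-}
module Submission where

-- Write x v = σ v * w v. Row i of L σ is a sum over the edges e at i of (x i − x o) / w e,
-- o the other endpoint of e. At a vertex k where x is maximal all these terms are ≥ 0 and
-- they sum to (L σ) k = 0, so they vanish and x is maximal at every neighbour of k too.
-- By connectedness x is maximal, hence constant, everywhere.

open import Defs
open import Data.Nat using (ℕ)
open import Data.Integer using (ℤ; +_; _*_)
open import Data.Fin using (Fin)
open import Relation.Binary.PropositionalEquality using (_≡_)

import Data.Nat as ℕ
open import Data.Nat.Divisibility using (_∣_)
open import Data.Nat.DivMod using (_/_; m/n*n≡m)
open import Data.Integer using (0ℤ; -_; _-_; _+_; _≤_; +<+; positive; nonNegative)
open import Data.Integer.Properties
  using (≤-refl; ≤-antisym; ≤-reflexive; ≤-trans; ≤-totalOrder; +-mono-≤; +-comm;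
         +-identityˡ; +-identityʳ; i≤i+j; i≤j+i; neg-distrib-+; neg-distribˡ-*; *-distribʳ-+;
         pos-*; *-cancelʳ-≤-pos; i≤j⇒0≤j-i; i-j≡0⇒i≡j)
open import Data.Integer.Tactic.RingSolver using (solve-∀)
open import Data.Fin using (zero; suc; _≟_)
open import Data.Fin.Properties using (suc-injective)
open import Data.List using (allFin)
open import Data.List.Extrema ≤-totalOrder using (argmax; f[xs]≤f[argmax])
open import Data.List.Membership.Propositional.Properties using (∈-allFin)
open import Data.List.Relation.Unary.All using (lookup)
open import Data.Bool using (true; false; T; _∧_; if_then_else_)
open import Data.Bool.Properties using (T-∨; T-∧)
open import Data.Empty using (⊥-elim)
open import Data.Product using (∃; _×_; _,_; proj₁; proj₂)
open import Data.Sum using (_⊎_; inj₁; inj₂)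
open import Function using (id; _∘_; _⇔_; mk⇔; Equivalence)
open import Function.Construct.Composition using (_⇔-∘_)
open import Data.Sum.Function.Propositional using (_⊎-⇔_)
open import Data.Product.Function.NonDependent.Propositional using (_×-⇔_)
open import Relation.Nullary using (¬_; Dec; yes; no)
open import Relation.Nullary.Decidable using (T?; True; ⌊_⌋; toWitness; fromWitness)
open import Relation.Binary.Core using (Rel)
open import Relation.Binary.Definitions using (_Respects_)
open import Relation.Binary.PropositionalEquality using (refl; sym; trans; cong; cong₂; subst; module ≡-Reasoning)
open import Relation.Binary.Construct.Closure.ReflexiveTransitive using (Star; ε; _◅_)

open Equivalence using (to; from)

∑-cong : ∀ n {f g : Fin n → ℤ} → (∀ i → f i ≡ g i) → ∑ n f ≡ ∑ n g
∑-cong ℕ.zero    f≗g = refl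
∑-cong (ℕ.suc n) f≗g = cong₂ _+_ (f≗g zero) (∑-cong n (f≗g ∘ suc))

∑-zero : ∀ n {f : Fin n → ℤ} → (∀ i → f i ≡ 0ℤ) → ∑ n f ≡ 0ℤ
∑-zero ℕ.zero    f≗0 = refl
∑-zero (ℕ.suc n) f≗0 = cong₂ _+_ (f≗0 zero) (∑-zero n (f≗0 ∘ suc))

∑-distrib-+ : ∀ n (f g : Fin n → ℤ) → ∑ n (λ i → f i + g i) ≡ ∑ n f + ∑ n g
∑-distrib-+ ℕ.zero    f g = refl
∑-distrib-+ (ℕ.suc n) f g =
  trans (cong (_+_ (f zero + g zero)) (∑-distrib-+ n (f ∘ suc) (g ∘ suc)))
        (interchange (f zero) (g zero) (∑ n (f ∘ suc)) (∑ n (g ∘ suc)))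
  where
  interchange : ∀ a b c d → a + b + (c + d) ≡ a + c + (b + d)
  interchange = solve-∀

∑-distribʳ-* : ∀ n (f : Fin n → ℤ) c → ∑ n (λ i → f i * c) ≡ ∑ n f * c
∑-distribʳ-* ℕ.zero    f c = refl
∑-distribʳ-* (ℕ.suc n) f c =
  trans (cong (_+_ (f zero * c)) (∑-distribʳ-* n (f ∘ suc) c)) (sym (*-distribʳ-+ c (f zero) _))

∑-neg : ∀ n (f : Fin n → ℤ) → ∑ n (λ i → - f i) ≡ - ∑ n f
∑-neg ℕ.zero    f = refl
∑-neg (ℕ.suc n) f = trans (cong (_+_ (- f zero)) (∑-neg n (f ∘ suc))) (sym (neg-distrib-+ (f zero) _))

∑-comm : ∀ n m (f : Fin n → Fin m → ℤ) → ∑ n (λ i → ∑ m (f i)) ≡ ∑ m (λ j → ∑ n (λ i → f i j))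
∑-comm ℕ.zero    m f = sym (∑-zero m (λ _ → refl))
∑-comm (ℕ.suc n) m f =
  trans (cong (_+_ (∑ m (f zero))) (∑-comm n m (f ∘ suc))) (sym (∑-distrib-+ m (f zero) _))

∑-select : ∀ n (f : Fin n → ℤ) k → (∀ i → ¬ i ≡ k → f i ≡ 0ℤ) → ∑ n f ≡ f k
∑-select (ℕ.suc n) f zero    off =
  trans (cong (_+_ (f zero)) (∑-zero n (λ i → off (suc i) λ ()))) (+-identityʳ _)
∑-select (ℕ.suc n) f (suc k) off =
  trans (cong₂ _+_ (off zero λ ()) (∑-select n (f ∘ suc) k (λ i i≢k → off (suc i) (i≢k ∘ suc-injective))))
        (+-identityˡ _)

∑-select₂ : ∀ n (f : Fin n → ℤ) {k l} → ¬ k ≡ l → (∀ i → ¬ i ≡ k → ¬ i ≡ l → f i ≡ 0ℤ) →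
            ∑ n f ≡ f k + f l
∑-select₂ (ℕ.suc n) f {zero}  {zero}  k≢l _ = ⊥-elim (k≢l refl)
∑-select₂ (ℕ.suc n) f {zero}  {suc l} _ off =
  cong (_+_ (f zero)) (∑-select n (f ∘ suc) l (λ i i≢l → off (suc i) (λ ()) (i≢l ∘ suc-injective)))
∑-select₂ (ℕ.suc n) f {suc k} {zero}  _ off =
  trans (cong (_+_ (f zero)) (∑-select n (f ∘ suc) k (λ i i≢k → off (suc i) (i≢k ∘ suc-injective) (λ ()))))
        (+-comm (f zero) (f (suc k)))
∑-select₂ (ℕ.suc n) f {suc k} {suc l} k≢l off =
  trans (cong₂ _+_ (off zero (λ ()) (λ ()))
                   (∑-select₂ n (f ∘ suc) (k≢l ∘ cong suc)
                     (λ i i≢k i≢l → off (suc i) (i≢k ∘ suc-injective) (i≢l ∘ suc-injective))))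
        (+-identityˡ _)

∑-nonneg : ∀ n {f : Fin n → ℤ} → (∀ i → 0ℤ ≤ f i) → 0ℤ ≤ ∑ n f
∑-nonneg ℕ.zero    f≥0 = ≤-refl
∑-nonneg (ℕ.suc n) f≥0 = +-mono-≤ (f≥0 zero) (∑-nonneg n (f≥0 ∘ suc))

≤-∑-nonneg : ∀ n {f : Fin n → ℤ} → (∀ i → 0ℤ ≤ f i) → ∀ k → f k ≤ ∑ n f
≤-∑-nonneg (ℕ.suc n) {f} f≥0 zero    = i≤i+j (f zero) _ {{nonNegative (∑-nonneg n (f≥0 ∘ suc))}}
≤-∑-nonneg (ℕ.suc n) {f} f≥0 (suc k) =
  ≤-trans (≤-∑-nonneg n (f≥0 ∘ suc) k) (i≤j+i _ (f zero) {{nonNegative (f≥0 zero)}})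

∃-maximum : ∀ {n} (f : Fin n → ℤ) → Fin n → ∃ λ k → ∀ i → f i ≤ f k
∃-maximum {n} f i₀ =
  argmax f i₀ (allFin n) , λ i → lookup (f[xs]≤f[argmax] {f = f} i₀ (allFin n)) (∈-allFin i)

Star-respects : ∀ {a ℓ p} {A : Set a} {R : Rel A ℓ} {P : A → Set p} →
                P Respects R → P Respects Star R
Star-respects resp ε        = id
Star-respects resp (r ◅ rs) = Star-respects resp rs ∘ resp r

True⇔ : ∀ {p} {P : Set p} (p? : Dec P) → True p? ⇔ P
True⇔ p? = mk⇔ toWitness fromWitness

if-T : ∀ {a} {A : Set a} {b} {x y : A} → T b → (if b then x else y) ≡ x
if-T {b = true} _ = refl

if-¬T : ∀ {a} {A : Set a} {b} {x y : A} → ¬ T b → (if b then x else y) ≡ y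
if-¬T {b = false} _  = refl
if-¬T {b = true}  ¬t = ⊥-elim (¬t _)

module _ {n m : ℕ} (G : WeightedGraph n m) where
  open WeightedGraph G

  Joins : Fin m → Fin n → Fin n → Set
  Joins e u v = (src e ≡ u × tgt e ≡ v) ⊎ (src e ≡ v × tgt e ≡ u)

  incident⇔ : ∀ u e → T (incident G u e) ⇔ (src e ≡ u ⊎ tgt e ≡ u)
  incident⇔ u e =
    (True⇔ (src e ≟ u) ⊎-⇔ True⇔ (tgt e ≟ u)) ⇔-∘ T-∨ {⌊ src e ≟ u ⌋} {⌊ tgt e ≟ u ⌋}

  joins⇔ : ∀ u v e → T (joins G u v e) ⇔ Joins e u v
  joins⇔ u v e = (both (src e ≟ u) (tgt e ≟ v) ⊎-⇔ both (src e ≟ v) (tgt e ≟ u))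
                 ⇔-∘ T-∨ {⌊ src e ≟ u ⌋ ∧ ⌊ tgt e ≟ v ⌋} {⌊ src e ≟ v ⌋ ∧ ⌊ tgt e ≟ u ⌋}
    where
    both : ∀ {x y} (x? : Dec (src e ≡ x)) (y? : Dec (tgt e ≡ y)) →
           T (⌊ x? ⌋ ∧ ⌊ y? ⌋) ⇔ (src e ≡ x × tgt e ≡ y)
    both x? y? = (True⇔ x? ×-⇔ True⇔ y?) ⇔-∘ T-∧ {⌊ x? ⌋} {⌊ y? ⌋}

  incident-complete : ∀ {e u v} → Joins e u v → T (incident G u e)
  incident-complete {e} {u} (inj₁ (p , _)) = from (incident⇔ u e) (inj₁ p)
  incident-complete {e} {u} (inj₂ (_ , q)) = from (incident⇔ u e) (inj₂ q)

  incident-sound : ∀ {e u} → T (incident G u e) → ∃ (Joins e u)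
  incident-sound {e} {u} t with to (incident⇔ u e) t
  ... | inj₁ p = tgt e , inj₁ (p , refl)
  ... | inj₂ q = src e , inj₂ (refl , q)

  Joins-irrefl : ∀ {e u v} → Joins e u v → ¬ u ≡ v
  Joins-irrefl {e} (inj₁ (p , q)) u≡v = noLoop e (trans p (trans u≡v (sym q)))
  Joins-irrefl {e} (inj₂ (p , q)) u≡v = noLoop e (trans p (trans (sym u≡v) (sym q)))

  Joins-functional : ∀ {e u v w} → Joins e u v → Joins e u w → v ≡ w
  Joins-functional     (inj₁ (_ , q)) (inj₁ (_ , q′)) = trans (sym q) q′
  Joins-functional {e} (inj₁ (p , _)) (inj₂ (_ , q′)) = ⊥-elim (noLoop e (trans p (sym q′)))
  Joins-functional {e} (inj₂ (_ , q)) (inj₁ (p′ , _)) = ⊥-elim (noLoop e (trans p′ (sym q)))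
  Joins-functional     (inj₂ (p , _)) (inj₂ (p′ , _)) = trans (sym p) p′

  wE∣endpoints : ∀ {e u v} → Joins e u v → wE e ∣ wV u × wE e ∣ wV v
  wE∣endpoints {e} (inj₁ (refl , refl)) = wE∣src e , wE∣tgt e
  wE∣endpoints {e} (inj₂ (refl , refl)) = wE∣tgt e , wE∣src e

  ratio-*-wE : ∀ v e → wE e ∣ wV v → ratio G v e * + wE e ≡ + wV v
  ratio-*-wE v e wE∣wV =
    trans (sym (pos-* (_/_ (wV v) (wE e) {{wE-pos e}}) (wE e))) (cong +_ (m/n*n≡m {{wE-pos e}} wE∣wV))

  laplacianTerm : Fin n → Fin n → Fin m → ℤ
  laplacianTerm i j e with i ≟ j
  ... | yes _ = if incident G i e then ratio G i e else 0ℤ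
  ... | no  _ = - (if joins G i j e then ratio G j e else 0ℤ)

  Laplacian≡∑ : ∀ i j → Laplacian G i j ≡ ∑ m (laplacianTerm i j)
  Laplacian≡∑ i j with i ≟ j
  ... | yes _ = refl
  ... | no  _ = sym (∑-neg m _)

  laplacianTerm-diag : ∀ i e → laplacianTerm i i e ≡ (if incident G i e then ratio G i e else 0ℤ)
  laplacianTerm-diag i e with i ≟ i
  ... | yes _   = refl
  ... | no  i≢i = ⊥-elim (i≢i refl)

  laplacianTerm-off : ∀ {i j} e → ¬ i ≡ j →
                      laplacianTerm i j e ≡ - (if joins G i j e then ratio G j e else 0ℤ)
  laplacianTerm-off {i} {j} e i≢j with i ≟ j
  ... | yes i≡j = ⊥-elim (i≢j i≡j)
  ... | no  _   = refl

  module _ (σ : Fin n → ℤ) where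

    -- The contribution of e to (L σ) i; by edgeTerm-*-wE it is (scaled i − scaled o) / wE e.
    edgeTerm : Fin n → Fin m → ℤ
    edgeTerm i e = ∑ n (λ j → laplacianTerm i j e * σ j)

    applyL≡∑edgeTerm : ∀ i → applyL G σ i ≡ ∑ m (edgeTerm i)
    applyL≡∑edgeTerm i = begin
      ∑ n (λ j → Laplacian G i j * σ j)                  ≡⟨ ∑-cong n expand ⟩
      ∑ n (λ j → ∑ m (λ e → laplacianTerm i j e * σ j))  ≡⟨ ∑-comm n m _ ⟩
      ∑ m (edgeTerm i)                                   ∎
      where
      open ≡-Reasoning
      expand : ∀ j → Laplacian G i j * σ j ≡ ∑ m (λ e → laplacianTerm i j e * σ j)
      expand j = trans (cong (_* σ j) (Laplacian≡∑ i j)) (sym (∑-distribʳ-* m _ (σ j)))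

    edgeTerm-incident : ∀ {i o e} → Joins e i o →
                        edgeTerm i e ≡ ratio G i e * σ i - ratio G o e * σ o
    edgeTerm-incident {i} {o} {e} J =
      trans (∑-select₂ n _ (Joins-irrefl J) elsewhere) (cong₂ _+_ at-i at-o)
      where
      at-i : laplacianTerm i i e * σ i ≡ ratio G i e * σ i
      at-i = cong (_* σ i) (trans (laplacianTerm-diag i e) (if-T (incident-complete J)))
      at-o : laplacianTerm i o e * σ o ≡ - (ratio G o e * σ o)
      at-o = trans (cong (_* σ o) entry) (sym (neg-distribˡ-* (ratio G o e) (σ o)))
        where
        entry = trans (laplacianTerm-off e (Joins-irrefl J)) (cong -_ (if-T (from (joins⇔ i o e) J)))
      elsewhere : ∀ j → ¬ j ≡ i → ¬ j ≡ o → laplacianTerm i j e * σ j ≡ 0ℤ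
      elsewhere j j≢i j≢o = cong (_* σ j) (trans (laplacianTerm-off e (j≢i ∘ sym))
        (cong -_ (if-¬T (λ t → j≢o (Joins-functional (to (joins⇔ i j e) t) J)))))

    edgeTerm-nonincident : ∀ {i e} → ¬ T (incident G i e) → edgeTerm i e ≡ 0ℤ
    edgeTerm-nonincident {i} {e} ¬inc = ∑-zero n vanishes
      where
      vanishes : ∀ j → laplacianTerm i j e * σ j ≡ 0ℤ
      vanishes j with i ≟ j
      ... | yes _ = cong (_* σ j) (if-¬T ¬inc)
      ... | no  _ = cong (λ z → - z * σ j) (if-¬T (¬inc ∘ incident-complete ∘ to (joins⇔ i j e)))

    scaled : Fin n → ℤ
    scaled i = σ i * + wV i

    edgeTerm-*-wE : ∀ {i o e} → Joins e i o → edgeTerm i e * + wE e ≡ scaled i - scaled o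
    edgeTerm-*-wE {i} {o} {e} J = begin
      edgeTerm i e * + wE e
        ≡⟨ cong (_* + wE e) (edgeTerm-incident J) ⟩
      (ratio G i e * σ i - ratio G o e * σ o) * + wE e
        ≡⟨ regroup (ratio G i e) (ratio G o e) (σ i) (σ o) (+ wE e) ⟩
      σ i * (ratio G i e * + wE e) - σ o * (ratio G o e * + wE e)
        ≡⟨ cong₂ (λ a b → σ i * a - σ o * b) (ratio-*-wE i e wE∣wVᵢ) (ratio-*-wE o e wE∣wVₒ) ⟩
      scaled i - scaled o
        ∎
      where
      open ≡-Reasoning
      wE∣wVᵢ = proj₁ (wE∣endpoints J)
      wE∣wVₒ = proj₂ (wE∣endpoints J)
      regroup : ∀ a b s t w → (a * s - b * t) * w ≡ s * (a * w) - t * (b * w)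
      regroup = solve-∀

module MaximumPrinciple {n m : ℕ} (G : WeightedGraph n m) (σ : Fin n → ℤ)
                        (harmonic : ∀ i → applyL G σ i ≡ 0ℤ) where
  open WeightedGraph G

  IsMaximum : Fin n → Set
  IsMaximum k = ∀ i → scaled G σ i ≤ scaled G σ k

  edgeTerm-nonneg : ∀ {k} → IsMaximum k → ∀ e → 0ℤ ≤ edgeTerm G σ k e
  edgeTerm-nonneg {k} k-max e with T? (incident G k e)
  ... | no ¬inc = ≤-reflexive (sym (edgeTerm-nonincident G σ ¬inc))
  ... | yes inc with incident-sound G inc
  ...   | o , J = *-cancelʳ-≤-pos 0ℤ (edgeTerm G σ k e) (+ wE e) {{wE>0}}
                    (subst (0ℤ ≤_) (sym (edgeTerm-*-wE G σ J)) (i≤j⇒0≤j-i (k-max o)))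
    where wE>0 = positive (+<+ (ℕ.>-nonZero⁻¹ (wE e) {{wE-pos e}}))

  -- The edge terms at a maximum are nonnegative and, as σ is harmonic, sum to zero.
  edgeTerm≡0 : ∀ {k} → IsMaximum k → ∀ e → edgeTerm G σ k e ≡ 0ℤ
  edgeTerm≡0 {k} k-max e = ≤-antisym
    (subst (edgeTerm G σ k e ≤_) row≡0 (≤-∑-nonneg m (edgeTerm-nonneg k-max) e))
    (edgeTerm-nonneg k-max e)
    where row≡0 = trans (sym (applyL≡∑edgeTerm G σ k)) (harmonic k)

  neighbour-of-maximum : ∀ {k v e} → IsMaximum k → Joins G e k v → scaled G σ v ≡ scaled G σ k
  neighbour-of-maximum {k} {v} {e} k-max J = sym (i-j≡0⇒i≡j (scaled G σ k) (scaled G σ v)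
    (trans (sym (edgeTerm-*-wE G σ J)) (cong (_* + wE e) (edgeTerm≡0 k-max e))))

  maximum-spreads : IsMaximum Respects Adjacent G
  maximum-spreads (e , J) k-max i = subst (scaled G σ i ≤_) (sym (neighbour-of-maximum k-max J)) (k-max i)

mainTheorem1 : ∀ {n m : ℕ} (G : WeightedGraph n m) → Connected G →
    (σ : Fin n → ℤ) → (∀ i → applyL G σ i ≡ + 0) →
    ∀ u v → σ u * + WeightedGraph.wV G u ≡ σ v * + WeightedGraph.wV G v
mainTheorem1 G connected σ harmonic u v = ≤-antisym (everywhere-maximal v u) (everywhere-maximal u v)
  where
  open MaximumPrinciple G σ harmonic
  everywhere-maximal : ∀ w → IsMaximum w
  everywhere-maximal w with ∃-maximum (scaled G σ) u
  ... | k , k-max = Star-respects maximum-spreads (connected k w) k-max
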